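{- The finite projective plane $\Omega$ of order $9$ is not a Poncelet plane.
   Context: Miniquaternion near-field $\mathfrak{S}=\{0,\pm1,\pm i,\pm j,\pm k\}$: as an additive group it is $\{a+bi: a,b\in GF(3)\}$ with $j:=1+i$, $k:=1-i$ (coefficients mod $3$); multiplication on $\mathfrak{S}\setminus\{0\}$ is the quaternion group: $i^2=j^2=k^2=-1$, $ij=k=-ji$, $jk=i=-kj$, $ki=j=-ik$, $-1$ central, $0\cdot x=x\cdot 0=0$; it satisfies $(m+n)l=ml+nl$ but not left distributivity. The plane $\Omega$ has points: the $81$ proper points $(x,y)$, $x,y\in\mathfrak{S}$; the $9$ ideal points $(1,\mu,0)$, $\mu\in\mathfrak{S}$; and the ideal point $(0,1,0)$. Its lines: for $\mu,\nu\in\mathfrak{S}$ the line $y=x\mu+\nu$, consisting of the proper points $(x,y)$ with $y=x\mu+\nu$ together with the ideal point $(1,\mu,0)$; for $\lambda\in\mathfrak{S}$ the line $x=\lambda$, consisting of the points $(\lambda,y)$, $y\in\mathfrak{S}$, and $(0,1,0)$; and the ideal line consisting of all $10$ ideal points. This is a projective plane of order $9$. An oval in a plane of order $n$ is a set of $n+1$ points no three collinear; secants/tangents of an oval are lines meeting it in two/exactly one point. For an ordered pair of ovals $(O_t,O_s)$, an $m$-sided Poncelet polygon ($3\le m\le n+1$) is a cyclically ordered $m$-tuple of distinct points of $O_s$ with every line joining cyclically consecutive vertices a tangent of $O_t$. $(O_t,O_s)$ is a Poncelet $m$-pair if an $m$-sided Poncelet polygon exists but no $m'$-sided one for $m'\neq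 m$, $3\le m'\le n+1$; a Poncelet $0$-pair if no secant of $O_s$ is a tangent of $O_t$; a Poncelet $\infty$-pair if some secant of $O_s$ is tangent to $O_t$ but no Poncelet polygon exists. A Poncelet plane is one in which every pair of ovals is a Poncelet $m$-pair ($3\le m\le n+1$), a Poncelet $0$-pair or a Poncelet $\infty$-pair. -}

module Defs where

open import Data.Nat using (ℕ; zero; suc; _≤_; _≟_)
open import Data.Nat.Properties using (suc-injective)
open import Data.Fin using (Fin; toℕ; lower₁) renaming (zero to fzero; suc to fsuc)
open import Data.List using (List; length)
open import Data.List.Membership.Propositional using (_∈_)
open import Data.List.Relation.Unary.Unique.Propositional using (Unique)
open import Data.Product using (Σ; ∃; _×_; _,_)
open import Data.Sum using (_⊎_)
open import Data.Empty using (⊥)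
open import Data.Unit using (⊤)
open import Relation.Nullary using (¬_; yes; no)
open import Relation.Binary.PropositionalEquality using (_≡_; _≢_; refl; cong; sym)
open import Function.Definitions using (Injective)

data Z3 : Set where
  z0 z1 z2 : Z3

_+₃_ : Z3 → Z3 → Z3
z0 +₃ b = b
z1 +₃ z0 = z1
z1 +₃ z1 = z2
z1 +₃ z2 = z0
z2 +₃ z0 = z2
z2 +₃ z1 = z0
z2 +₃ z2 = z1

-- The miniquaternion near-field 𝔖 = {0, ±1, ±i, ±j, ±k}

data Sign : Set where
  pos neg : Sign

data Unit : Set where
  u1 ui uj uk : Unit

data S : Set where
  𝟘 : S
  el : Sign → Unit → S

-- additive structure: a + b i with a, b ∈ GF(3), j = 1 + i, k = 1 - i
negZ : Z3 → Z3
negZ z0 = z0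
negZ z1 = z2
negZ z2 = z1

ucoord : Unit → Z3 × Z3
ucoord u1 = z1 , z0
ucoord ui = z0 , z1
ucoord uj = z1 , z1
ucoord uk = z1 , z2

coord : S → Z3 × Z3
coord 𝟘 = z0 , z0
coord (el pos u) = ucoord u
coord (el neg u) with ucoord u
... | a , b = negZ a , negZ b

fromCoord : Z3 × Z3 → S
fromCoord (z0 , z0) = 𝟘
fromCoord (z1 , z0) = el pos u1
fromCoord (z2 , z0) = el neg u1
fromCoord (z0 , z1) = el pos ui
fromCoord (z0 , z2) = el neg ui
fromCoord (z1 , z1) = el pos uj
fromCoord (z2 , z2) = el neg uj
fromCoord (z1 , z2) = el pos uk
fromCoord (z2 , z1) = el neg uk

infixl 6 _⊕_
_⊕_ : S → S → S
x ⊕ y with coord x | coord y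
... | a , b | c , d = fromCoord (a +₃ c , b +₃ d)

-- multiplicative structure: quaternion group on 𝔖 ∖ {0}
_·ₛ_ : Sign → Sign → Sign
pos ·ₛ s = s
neg ·ₛ pos = neg
neg ·ₛ neg = pos

_·ᵤ_ : Unit → Unit → Sign × Unit
u1 ·ᵤ u = pos , u
ui ·ᵤ u1 = pos , ui
ui ·ᵤ ui = neg , u1
ui ·ᵤ uj = pos , uk
ui ·ᵤ uk = neg , uj
uj ·ᵤ u1 = pos , uj
uj ·ᵤ ui = neg , uk
uj ·ᵤ uj = neg , u1
uj ·ᵤ uk = pos , ui
uk ·ᵤ u1 = pos , uk
uk ·ᵤ ui = pos , uj
uk ·ᵤ uj = neg , ui
uk ·ᵤ uk = neg , u1

infixl 7 _⊗_
_⊗_ : S → S → S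
𝟘 ⊗ y = 𝟘
el s u ⊗ 𝟘 = 𝟘
el s u ⊗ el t v with u ·ᵤ v
... | r , w = el ((s ·ₛ t) ·ₛ r) w

data Point : Set where
  proper : S → S → Point
  ideal  : S → Point          -- (1 , μ , 0)
  idealV : Point              -- (0 , 1 , 0)

data Line : Set where
  slope : S → S → Line
  vert  : S → Line
  lineInf : Line

_I_ : Point → Line → Set
proper x y I slope μ ν = y ≡ x ⊗ μ ⊕ ν
ideal μ' I slope μ ν = μ' ≡ μ
idealV I slope μ ν = ⊥
proper x y I vert λ' = x ≡ λ'
ideal μ I vert λ' = ⊥
idealV I vert λ' = ⊤
proper x y I lineInf = ⊥
ideal μ I lineInf = ⊤
idealV I lineInf = ⊤

-- Ovals (a point set is a duplicate-free list of points)

order : ℕ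
order = 9

NoThreeCollinear : List Point → Set
NoThreeCollinear O = ∀ {p q r} → p ∈ O → q ∈ O → r ∈ O →
  p ≢ q → q ≢ r → p ≢ r → ∀ (l : Line) → ¬ (p I l × q I l × r I l)

IsOval : List Point → Set
IsOval O = Unique O × length O ≡ suc order × NoThreeCollinear O

Tangent : List Point → Line → Set
Tangent O l = Σ Point λ p → p ∈ O × p I l × (∀ {q} → q ∈ O → q I l → q ≡ p)

Secant : List Point → Line → Set
Secant O l = Σ Point λ p → Σ Point λ q → p ∈ O × q ∈ O × p ≢ q × p I l × q I l ×
  (∀ {r} → r ∈ O → r I l → r ≡ p ⊎ r ≡ q)

next : ∀ {m} → Fin m → Fin m
next {suc m} i with toℕ i ≟ m
... | yes _ = fzero
... | no ne = lower₁ (fsuc i) λ e → ne (suc-injective (sym e))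

PonceletPolygon : List Point → List Point → (m : ℕ) → (Fin m → Point) → Set
PonceletPolygon Ot Os m v =
  Injective _≡_ _≡_ v ×
  (∀ i → v i ∈ Os) ×
  (∀ i (l : Line) → v i I l → v (next i) I l → Tangent Ot l)

HasPolygon : List Point → List Point → ℕ → Set
HasPolygon Ot Os m = Σ (Fin m → Point) (PonceletPolygon Ot Os m)

InRange : ℕ → Set
InRange m = 3 ≤ m × m ≤ suc order

PonceletMPair : List Point → List Point → ℕ → Set
PonceletMPair Ot Os m = HasPolygon Ot Os m ×
  (∀ m' → InRange m' → m' ≢ m → ¬ HasPolygon Ot Os m')

Poncelet0Pair : List Point → List Point → Set
Poncelet0Pair Ot Os = ∀ l → Secant Os l → ¬ Tangent Ot l

PonceletInfPair : List Point → List Point → Set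
PonceletInfPair Ot Os = (Σ Line λ l → Secant Os l × Tangent Ot l) ×
  (∀ m → InRange m → ¬ HasPolygon Ot Os m)

PonceletPlane : Set
PonceletPlane = ∀ Ot Os → IsOval Ot → IsOval Os →
  (Σ ℕ λ m → InRange m × PonceletMPair Ot Os m) ⊎ Poncelet0Pair Ot Os ⊎ PonceletInfPair Ot Os

-- Poncelet's porism fails in Ω: the two ovals Ot and Os below admit both a
-- Poncelet triangle and a Poncelet quadrilateral. Having polygons of two sizes,
-- the pair is not an m-pair; having a polygon at all, it is not an ∞-pair; and
-- a side of the triangle is a secant of Os tangent to Ot, so it is not a
-- 0-pair either. The ovals and polygons are verified by exhaustive search over
-- the 91 points and 91 lines of Ω.
module Submission where

open import Defs

open import Data.Nat using (ℕ; suc; _≤_; _≤?_; _≟_; s≤s)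
open import Data.Nat.Properties using (0≢1+n; 1+n≢n; suc-injective)
open import Data.Fin using (Fin; toℕ) renaming (zero to fzero; suc to fsuc)
import Data.Fin.Properties as Fin
open import Data.List using (List; []; _∷_; length; filter)
open import Data.List.Membership.Propositional using (_∈_; find)
open import Data.List.Membership.Propositional.Properties using (∈-filter⁺)
open import Data.List.Relation.Unary.Any using (Any; here; there; any?)
open import Data.List.Relation.Unary.All as All using (All; all?)
open import Data.List.Relation.Unary.AllPairs using (allPairs?)
open import Data.List.Relation.Unary.Unique.Propositional using (Unique)
import Data.Product.Properties as Product
import Data.Sum.Properties as Sum
import Data.Unit.Properties as Unit
open import Data.Vec using (lookup) renaming (_∷_ to _∷ᵛ_; [] to []ᵛ)
open import Data.Product using (Σ; _×_; _,_)
open import Data.Sum using (_⊎_; inj₁; inj₂; [_,_])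
open import Data.Empty using (⊥-elim)
open import Data.Unit using (⊤; tt)
open import Function using (_∘_)
open import Relation.Nullary using (¬_; Dec; yes; no; ¬?)
open import Relation.Nullary.Decidable using (from-yes; map′; _×-dec_; _→-dec_)
open import Relation.Unary using (Decidable)
open import Relation.Binary.Definitions using (DecidableEquality)
open import Relation.Binary.PropositionalEquality using (_≡_; _≢_; refl; cong; sym; trans; subst)

Searchable : Set → Set₁
Searchable A = ∀ {P : A → Set} → Decidable P → Dec (∀ x → P x)

searchable-Fin : ∀ {n} → Searchable (Fin n)
searchable-Fin = Fin.all?

searchable-⊤ : Searchable ⊤
searchable-⊤ P? = map′ (λ h _ → h) (λ h → h tt) (P? tt)

searchable-× : ∀ {A B} → Searchable A → Searchable B → Searchable (A × B)
searchable-× ∀A ∀B P? =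
  map′ (λ h (a , b) → h a b) (λ h a b → h (a , b)) (∀A λ a → ∀B λ b → P? (a , b))

searchable-⊎ : ∀ {A B} → Searchable A → Searchable B → Searchable (A ⊎ B)
searchable-⊎ ∀A ∀B P? =
  map′ (λ (h₁ , h₂) → [ h₁ , h₂ ]) (λ h → h ∘ inj₁ , h ∘ inj₂) (∀A (P? ∘ inj₁) ×-dec ∀B (P? ∘ inj₂))

module Retract {A B : Set} (encode : A → B) (decode : B → A)
                (decode-encode : ∀ x → decode (encode x) ≡ x) where

  ≟-retract : DecidableEquality B → DecidableEquality A
  ≟-retract _≟ᴮ_ x y = map′ encode-injective (cong encode) (encode x ≟ᴮ encode y)
    where
    encode-injective : encode x ≡ encode y → x ≡ y
    encode-injective e = trans (sym (decode-encode x)) (trans (cong decode e) (decode-encode y))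

  searchable-retract : Searchable B → Searchable A
  searchable-retract ∀B {P} P? =
    map′ (λ h x → subst P (decode-encode x) (h (encode x))) (λ h y → h (decode y)) (∀B (P? ∘ decode))

Z3→Fin : Z3 → Fin 3
Z3→Fin z0 = fzero
Z3→Fin z1 = fsuc fzero
Z3→Fin z2 = fsuc (fsuc fzero)

Fin→Z3 : Fin 3 → Z3
Fin→Z3 fzero = z0
Fin→Z3 (fsuc fzero) = z1
Fin→Z3 (fsuc (fsuc fzero)) = z2

Fin→Z3-Z3→Fin : ∀ a → Fin→Z3 (Z3→Fin a) ≡ a
Fin→Z3-Z3→Fin z0 = refl
Fin→Z3-Z3→Fin z1 = refl
Fin→Z3-Z3→Fin z2 = refl

fromCoord-coord : ∀ x → fromCoord (coord x) ≡ x
fromCoord-coord 𝟘 = refl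
fromCoord-coord (el pos u1) = refl
fromCoord-coord (el pos ui) = refl
fromCoord-coord (el pos uj) = refl
fromCoord-coord (el pos uk) = refl
fromCoord-coord (el neg u1) = refl
fromCoord-coord (el neg ui) = refl
fromCoord-coord (el neg uj) = refl
fromCoord-coord (el neg uk) = refl

Shape : Set
Shape = (S × S) ⊎ (S ⊎ ⊤)

Point→Shape : Point → Shape
Point→Shape (proper x y) = inj₁ (x , y)
Point→Shape (ideal μ) = inj₂ (inj₁ μ)
Point→Shape idealV = inj₂ (inj₂ tt)

Shape→Point : Shape → Point
Shape→Point (inj₁ (x , y)) = proper x y
Shape→Point (inj₂ (inj₁ μ)) = ideal μ
Shape→Point (inj₂ (inj₂ _)) = idealV

Shape→Point-Point→Shape : ∀ p → Shape→Point (Point→Shape p) ≡ p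
Shape→Point-Point→Shape (proper x y) = refl
Shape→Point-Point→Shape (ideal μ) = refl
Shape→Point-Point→Shape idealV = refl

Line→Shape : Line → Shape
Line→Shape (slope μ ν) = inj₁ (μ , ν)
Line→Shape (vert λ') = inj₂ (inj₁ λ')
Line→Shape lineInf = inj₂ (inj₂ tt)

Shape→Line : Shape → Line
Shape→Line (inj₁ (μ , ν)) = slope μ ν
Shape→Line (inj₂ (inj₁ λ')) = vert λ'
Shape→Line (inj₂ (inj₂ _)) = lineInf

Shape→Line-Line→Shape : ∀ l → Shape→Line (Line→Shape l) ≡ l
Shape→Line-Line→Shape (slope μ ν) = refl
Shape→Line-Line→Shape (vert λ') = refl
Shape→Line-Line→Shape lineInf = refl

_≟Z3_ : DecidableEquality Z3
_≟Z3_ = Retract.≟-retract Z3→Fin Fin→Z3 Fin→Z3-Z3→Fin Fin._≟_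

searchable-Z3 : Searchable Z3
searchable-Z3 = Retract.searchable-retract Z3→Fin Fin→Z3 Fin→Z3-Z3→Fin searchable-Fin

_≟S_ : DecidableEquality S
_≟S_ = Retract.≟-retract coord fromCoord fromCoord-coord (Product.≡-dec _≟Z3_ _≟Z3_)

searchable-S : Searchable S
searchable-S = Retract.searchable-retract coord fromCoord fromCoord-coord
  (searchable-× searchable-Z3 searchable-Z3)

_≟P_ : DecidableEquality Point
_≟P_ = Retract.≟-retract Point→Shape Shape→Point Shape→Point-Point→Shape
  (Sum.≡-dec (Product.≡-dec _≟S_ _≟S_) (Sum.≡-dec _≟S_ Unit._≟_))

searchable-Line : Searchable Line
searchable-Line = Retract.searchable-retract Line→Shape Shape→Line Shape→Line-Line→Shape
  (searchable-⊎ (searchable-× searchable-S searchable-S) (searchable-⊎ searchable-S searchable-⊤))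

_I?_ : ∀ p l → Dec (p I l)
proper x y I? slope μ ν = y ≟S (x ⊗ μ ⊕ ν)
ideal μ' I? slope μ ν = μ' ≟S μ
idealV I? slope μ ν = no λ ()
proper x y I? vert λ' = x ≟S λ'
ideal μ I? vert λ' = no λ ()
idealV I? vert λ' = yes tt
proper x y I? lineInf = no λ ()
ideal μ I? lineInf = yes tt
idealV I? lineInf = yes tt

PointsOn : Line → List Point → List Point
PointsOn l = filter (_I? l)

at-most-two-members : ∀ {A : Set} {x y z : A} xs → length xs ≤ 2 →
  x ∈ xs → y ∈ xs → z ∈ xs → x ≡ y ⊎ y ≡ z ⊎ x ≡ z
at-most-two-members _ _ (here refl) (here refl) _ = inj₁ refl
at-most-two-members _ _ _ (here refl) (here refl) = inj₂ (inj₁ refl)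
at-most-two-members _ _ (here refl) _ (here refl) = inj₂ (inj₂ refl)
at-most-two-members _ _ (there (here refl)) (there (here refl)) _ = inj₁ refl
at-most-two-members _ _ _ (there (here refl)) (there (here refl)) = inj₂ (inj₁ refl)
at-most-two-members _ _ (there (here refl)) _ (there (here refl)) = inj₂ (inj₂ refl)
at-most-two-members (_ ∷ _ ∷ _ ∷ _) (s≤s (s≤s ()))
at-most-two-members (_ ∷ _ ∷ []) _ _ _ (there (there ()))
at-most-two-members (_ ∷ _ ∷ []) _ _ (there (there ())) _
at-most-two-members (_ ∷ _ ∷ []) _ (there (there ())) _ _

OvalCheck : List Point → Set
OvalCheck O = Unique O × length O ≡ suc order × (∀ l → length (PointsOn l O) ≤ 2)

oval? : ∀ O → Dec (OvalCheck O)
oval? O = allPairs? (λ p q → ¬? (p ≟P q)) O ×-dec length O ≟ suc order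
  ×-dec searchable-Line (λ l → length (PointsOn l O) ≤? 2)

OvalCheck⇒IsOval : ∀ {O} → OvalCheck O → IsOval O
OvalCheck⇒IsOval {O} (unique , len , meets≤2) = unique , len , noThree
  where
  noThree : NoThreeCollinear O
  noThree p∈ q∈ r∈ p≢q q≢r p≢r l (pl , ql , rl)
    with at-most-two-members (PointsOn l O) (meets≤2 l)
           (∈-filter⁺ (_I? l) p∈ pl) (∈-filter⁺ (_I? l) q∈ ql) (∈-filter⁺ (_I? l) r∈ rl)
  ... | inj₁ p≡q = p≢q p≡q
  ... | inj₂ (inj₁ q≡r) = q≢r q≡r
  ... | inj₂ (inj₂ p≡r) = p≢r p≡r

TangentAt : List Point → Line → Point → Set
TangentAt O l p = p I l × All (λ q → q I l → q ≡ p) O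

tangent? : ∀ O l → Dec (Any (TangentAt O l) O)
tangent? O l = any? (λ p → p I? l ×-dec all? (λ q → q I? l →-dec q ≟P p) O) O

Any-TangentAt⇒Tangent : ∀ {O l} → Any (TangentAt O l) O → Tangent O l
Any-TangentAt⇒Tangent t with find t
... | p , p∈O , pl , unique = p , p∈O , pl , λ q∈O ql → All.lookup unique q∈O ql

PolygonCheck : List Point → List Point → (m : ℕ) → (Fin m → Point) → Set
PolygonCheck Ot Os m v = (∀ i j → v i ≡ v j → i ≡ j) × (∀ i → v i ∈ Os) ×
  (∀ i l → v i I l → v (next i) I l → Any (TangentAt Ot l) Ot)

polygon? : ∀ Ot Os m v → Dec (PolygonCheck Ot Os m v)
polygon? Ot Os m v =
  searchable-Fin (λ i → searchable-Fin λ j → v i ≟P v j →-dec i Fin.≟ j)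
  ×-dec searchable-Fin (λ i → any? (v i ≟P_) Os)
  ×-dec searchable-Fin (λ i → searchable-Line λ l →
          v i I? l →-dec (v (next i) I? l →-dec tangent? Ot l))

PolygonCheck⇒PonceletPolygon : ∀ {Ot Os m v} → PolygonCheck Ot Os m v → PonceletPolygon Ot Os m v
PolygonCheck⇒PonceletPolygon (injective , on-Os , tangent) =
  (λ {i} {j} → injective i j) , on-Os , λ i l vi vi′ → Any-TangentAt⇒Tangent (tangent i l vi vi′)

two-on-line⇒Secant : ∀ {O p q l} → NoThreeCollinear O →
  p ∈ O → q ∈ O → p ≢ q → p I l → q I l → Secant O l
two-on-line⇒Secant {O} {p} {q} {l} noThree p∈ q∈ p≢q pl ql =
  p , q , p∈ , q∈ , p≢q , pl , ql , onlyTwo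
  where
  onlyTwo : ∀ {r} → r ∈ O → r I l → r ≡ p ⊎ r ≡ q
  onlyTwo {r} r∈ rl with r ≟P p | r ≟P q
  ... | yes r≡p | _ = inj₁ r≡p
  ... | no _ | yes r≡q = inj₂ r≡q
  ... | no r≢p | no r≢q = ⊥-elim (noThree p∈ q∈ r∈ p≢q (r≢q ∘ sym) (r≢p ∘ sym) l (pl , ql , rl))

next-≢ : ∀ {m} (i : Fin (suc (suc m))) → next i ≢ i
next-≢ {m} i with toℕ i ≟ suc m
... | yes i≡last = λ 0≡i → 0≢1+n (trans (cong toℕ 0≡i) i≡last)
... | no i≢last = λ next≡i →
  1+n≢n (trans (sym (Fin.toℕ-lower₁ (fsuc i) (i≢last ∘ suc-injective ∘ sym))) (cong toℕ next≡i))

polygon-side⇒secant-tangent : ∀ {Ot Os m v} → IsOval Os → PonceletPolygon Ot Os (suc (suc m)) v →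
  ∀ i l → v i I l → v (next i) I l → Secant Os l × Tangent Ot l
polygon-side⇒secant-tangent (_ , _ , noThree) (injective , on-Os , tangent) i l vi vi′ =
  two-on-line⇒Secant noThree (on-Os i) (on-Os (next i)) (next-≢ i ∘ sym ∘ injective) vi vi′ ,
  tangent i l vi vi′

PonceletKind : List Point → List Point → Set
PonceletKind Ot Os =
  (Σ ℕ λ m → InRange m × PonceletMPair Ot Os m) ⊎ Poncelet0Pair Ot Os ⊎ PonceletInfPair Ot Os

polygons-of-two-sizes⇒¬PonceletKind : ∀ {Ot Os m m′} → InRange m → InRange m′ → m ≢ m′ →
  HasPolygon Ot Os m → HasPolygon Ot Os m′ →
  ∀ l → Secant Os l × Tangent Ot l → ¬ PonceletKind Ot Os
polygons-of-two-sizes⇒¬PonceletKind {m = m} m∈ m′∈ m≢m′ poly poly′ _ _ (inj₁ (k , _ , _ , onlyK))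
  with m ≟ k
... | yes refl = onlyK _ m′∈ (m≢m′ ∘ sym) poly′
... | no m≢k = onlyK m m∈ m≢k poly
polygons-of-two-sizes⇒¬PonceletKind _ _ _ _ _ l (secant , tangent) (inj₂ (inj₁ noTangentSecant)) =
  noTangentSecant l secant tangent
polygons-of-two-sizes⇒¬PonceletKind m∈ _ _ poly _ _ _ (inj₂ (inj₂ (_ , noPolygon))) =
  noPolygon _ m∈ poly

Ot Os : List Point
Ot = proper (el pos ui) (el pos uk) ∷ proper (el neg uj) (el neg u1) ∷ proper (el neg u1) (el neg uj)
   ∷ proper (el pos uj) (el neg uk) ∷ proper (el neg uk) (el neg ui) ∷ proper (el pos uk) (el pos uj)
   ∷ proper 𝟘 (el pos u1) ∷ proper (el neg ui) 𝟘 ∷ ideal 𝟘 ∷ idealV ∷ []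
Os = ideal (el neg ui) ∷ proper 𝟘 (el pos uj) ∷ proper (el neg u1) (el pos uj) ∷ proper 𝟘 (el neg u1)
   ∷ ideal (el pos ui) ∷ proper (el neg u1) (el pos ui) ∷ proper (el neg uk) (el neg u1)
   ∷ proper (el neg uk) (el pos u1) ∷ proper (el pos uj) (el pos u1) ∷ proper (el pos uj) (el pos ui) ∷ []

triangle : Fin 3 → Point
triangle = lookup (proper 𝟘 (el pos uj) ∷ᵛ ideal (el pos ui) ∷ᵛ proper (el pos uj) (el pos u1) ∷ᵛ []ᵛ)

quadrilateral : Fin 4 → Point
quadrilateral = lookup (ideal (el neg ui) ∷ᵛ proper (el neg uk) (el neg u1)
  ∷ᵛ proper (el neg u1) (el pos ui) ∷ᵛ proper (el pos uj) (el pos ui) ∷ᵛ []ᵛ)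

Ot-oval : IsOval Ot
Ot-oval = OvalCheck⇒IsOval (from-yes (oval? Ot))

Os-oval : IsOval Os
Os-oval = OvalCheck⇒IsOval (from-yes (oval? Os))

triangle-poncelet : PonceletPolygon Ot Os 3 triangle
triangle-poncelet = PolygonCheck⇒PonceletPolygon (from-yes (polygon? Ot Os 3 triangle))

quadrilateral-poncelet : PonceletPolygon Ot Os 4 quadrilateral
quadrilateral-poncelet = PolygonCheck⇒PonceletPolygon (from-yes (polygon? Ot Os 4 quadrilateral))

-- y = x i + j, joining the first two vertices of the triangle.
triangle-side : Line
triangle-side = slope (el pos ui) (el pos uj)

theorem10 : ¬ PonceletPlane
theorem10 isPoncelet =
  polygons-of-two-sizes⇒¬PonceletKind in-range-3 in-range-4 (λ ())
    (triangle , triangle-poncelet) (quadrilateral , quadrilateral-poncelet)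
    triangle-side (polygon-side⇒secant-tangent Os-oval triangle-poncelet fzero triangle-side refl refl)
    (isPoncelet Ot Os Ot-oval Os-oval)
  where
  in-range-3 : InRange 3
  in-range-3 = from-yes ((3 ≤? 3) ×-dec (3 ≤? suc order))
  in-range-4 : InRange 4
  in-range-4 = from-yes ((3 ≤? 4) ×-dec (4 ≤? suc order))
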